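{- The following rules are admissible in the focused calculus (given focused derivations of the premises, there is a focused derivation of the conclusion): (ax) $A \mid\ \vdash_{\mathsf L} A$ for every formula $A$; ($\mathsf I$R) $- \mid\ \vdash_{\mathsf L} \mathsf I$; ($\otimes$R) from $S \mid \Gamma \vdash_{\mathsf L} A$ and $- \mid \Delta \vdash_{\mathsf L} B$ infer $S \mid \Gamma, \Delta \vdash_{\mathsf L} A \otimes B$; (scut) from $S \mid \Gamma \vdash_{\mathsf L} A$ and $A \mid \Delta \vdash_{\mathsf L} C$ infer $S \mid \Gamma, \Delta \vdash_{\mathsf L} C$; (ccut) from $- \mid \Gamma \vdash_{\mathsf L} A$ and $S \mid \Delta_0, A, \Delta_1 \vdash_{\mathsf L} C$ infer $S \mid \Delta_0, \Gamma, \Delta_1 \vdash_{\mathsf L} C$.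
   Context: Fix a set $\mathrm{Var}$ of atoms. Formulae: atoms $X \in \mathrm{Var}$, $\mathsf{I}$, and $A \otimes B$ for formulae $A, B$. A context is a finite list of formulae; a stoup $S$ is either empty (written $-$) or a single formula; a stoup $T$ is irreducible if $T = -$ or $T$ is an atom. Focused calculus: sequents $S \mid \Gamma \vdash_{\mathsf L} C$ and $T \mid \Gamma \vdash_{\mathsf R} C$ ($T$ irreducible), derived by exactly the rules: (pass) from $A \mid \Gamma \vdash_{\mathsf L} C$ infer $- \mid A, \Gamma \vdash_{\mathsf L} C$; (switch) from $T \mid \Gamma \vdash_{\mathsf R} C$ infer $T \mid \Gamma \vdash_{\mathsf L} C$; (ax) $X \mid\ \vdash_{\mathsf R} X$ for atoms $X$; ($\mathsf I$L) from $- \mid \Gamma \vdash_{\mathsf L} C$ infer $\mathsf I \mid \Gamma \vdash_{\mathsf L} C$; ($\mathsf I$R) $- \mid\ \vdash_{\mathsf R} \mathsf I$; ($\otimes$L) from $A \mid B, \Gamma \vdash_{\mathsf L} C$ infer $A \otimes B \mid \Gamma \vdash_{\mathsf L} C$; ($\otimes$R) from $T \mid \Gamma \vdash_{\mathsf R} A$ and $- \mid \Delta \vdash_{\mathsf L} B$ infer $T \mid \Gamma, \Delta \vdash_{\mathsf R} A \otimes B$. -}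

module Defs where

open import Data.List using (List; []; _∷_; _++_)
open import Data.Maybe using (Maybe; nothing; just)
open import Data.Product using (_×_)

data Fma (Var : Set) : Set where
  ` : Var → Fma Var
  I : Fma Var
  _⊗_ : Fma Var → Fma Var → Fma Var

Cxt : Set → Set
Cxt Var = List (Fma Var)

-- A stoup: nothing = empty stoup (-), just A = the formula A
Stp : Set → Set
Stp Var = Maybe (Fma Var)

data Irr {Var : Set} : Stp Var → Set where
  irr- : Irr nothing
  irrAt : (X : Var) → Irr (just (` X))

mutual
  data _∣_⊢L_ {Var : Set} : Stp Var → Cxt Var → Fma Var → Set where
    pass : {Γ : Cxt Var} {A C : Fma Var} →
           just A ∣ Γ ⊢L C → nothing ∣ A ∷ Γ ⊢L C
    switch : {T : Stp Var} {Γ : Cxt Var} {C : Fma Var} →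
             Irr T → T ∣ Γ ⊢R C → T ∣ Γ ⊢L C
    IL : {Γ : Cxt Var} {C : Fma Var} →
         nothing ∣ Γ ⊢L C → just I ∣ Γ ⊢L C
    ⊗L : {Γ : Cxt Var} {A B C : Fma Var} →
         just A ∣ B ∷ Γ ⊢L C → just (A ⊗ B) ∣ Γ ⊢L C

  data _∣_⊢R_ {Var : Set} : Stp Var → Cxt Var → Fma Var → Set where
    ax : {X : Var} → just (` X) ∣ [] ⊢R ` X
    IR : nothing ∣ [] ⊢R I
    ⊗R : {T : Stp Var} {Γ Δ : Cxt Var} {A B : Fma Var} →
         Irr T → T ∣ Γ ⊢R A → nothing ∣ Δ ⊢L B → T ∣ Γ ++ Δ ⊢R (A ⊗ B)

-- The derived rules are proved by structural recursion. (⊗R) and (ax) permute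
-- past the left rules until an irreducible stoup is reached. The two cuts are
-- proved simultaneously, by lexicographic induction on the cut formula and then
-- on the derivations: a stoup cut against an invertible left rule commutes with
-- it, and a cut of a right-focused A ⊗ B against ⊗L becomes a context cut on B
-- followed by a stoup cut on A.
module Submission where

open import Defs
open import Data.List using (List; []; _∷_; _++_)
open import Data.List.Properties using (++-assoc; ++-conicalʳ; ∷-injective)
open import Data.Maybe using (nothing; just)
open import Data.Product using (_×_; _,_; ∃-syntax)
open import Data.Sum using (_⊎_; inj₁; inj₂)
open import Data.Empty using (⊥-elim)
open import Relation.Binary.PropositionalEquality

split-++≡++∷ : {X : Set} (Γ Δ Δ₀ Δ₁ : List X) (A : X) → Γ ++ Δ ≡ Δ₀ ++ A ∷ Δ₁ →
  (∃[ Ξ ] Γ ≡ Δ₀ ++ A ∷ Ξ × Δ₁ ≡ Ξ ++ Δ) ⊎ (∃[ Ξ ] Δ₀ ≡ Γ ++ Ξ × Δ ≡ Ξ ++ A ∷ Δ₁)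
split-++≡++∷ []      Δ Δ₀       Δ₁ A eq   = inj₂ (Δ₀ , refl , eq)
split-++≡++∷ (x ∷ Γ) Δ []       Δ₁ A refl = inj₁ (Γ , refl , refl)
split-++≡++∷ (x ∷ Γ) Δ (y ∷ Δ₀) Δ₁ A eq
  with refl , eq′ ← ∷-injective eq
  with split-++≡++∷ Γ Δ Δ₀ Δ₁ A eq′
... | inj₁ (Ξ , refl , refl) = inj₁ (Ξ , refl , refl)
... | inj₂ (Ξ , refl , refl) = inj₂ (Ξ , refl , refl)

[]≢++∷ : {X : Set} (Δ₀ Δ₁ : List X) (A : X) → [] ≢ Δ₀ ++ A ∷ Δ₁
[]≢++∷ Δ₀ Δ₁ A eq with () ← ++-conicalʳ Δ₀ (A ∷ Δ₁) (sym eq)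

module _ {Var : Set} where

  cast-cxt : {S : Stp Var} {Γ Γ′ : Cxt Var} {C : Fma Var} →
             Γ ≡ Γ′ → S ∣ Γ ⊢L C → S ∣ Γ′ ⊢L C
  cast-cxt = subst (_ ∣_⊢L _)

  ⊗R-admissible : {S : Stp Var} {Γ Δ : Cxt Var} {A B : Fma Var} →
                  S ∣ Γ ⊢L A → nothing ∣ Δ ⊢L B → S ∣ Γ ++ Δ ⊢L (A ⊗ B)
  ⊗R-admissible (pass f)     g = pass (⊗R-admissible f g)
  ⊗R-admissible (switch i f) g = switch i (⊗R i f g)
  ⊗R-admissible (IL f)       g = IL (⊗R-admissible f g)
  ⊗R-admissible (⊗L f)       g = ⊗L (⊗R-admissible f g)

  ax-admissible : (A : Fma Var) → just A ∣ [] ⊢L A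
  ax-admissible (` X)   = switch (irrAt X) ax
  ax-admissible I       = IL (switch irr- IR)
  ax-admissible (A ⊗ B) = ⊗L (⊗R-admissible (ax-admissible A) (pass (ax-admissible B)))

  IR-admissible : nothing ∣ [] ⊢L I {Var}
  IR-admissible = switch irr- IR

  -- The context cut takes the splitting of its context as an equation, since a
  -- ⊗R premise with context Γ ++ Δ cannot be matched against Δ₀ ++ A ∷ Δ₁.
  mutual
    scut : (A : Fma Var) {S : Stp Var} {Γ Δ : Cxt Var} {C : Fma Var} →
           S ∣ Γ ⊢L A → just A ∣ Δ ⊢L C → S ∣ Γ ++ Δ ⊢L C
    scut A (pass f)     g = pass (scut A f g)
    scut A (switch _ f) g = scutR A f g
    scut A (IL f)       g = IL (scut A f g)
    scut A (⊗L f)       g = ⊗L (scut A f g)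

    scutR : (A : Fma Var) {T : Stp Var} {Γ Δ : Cxt Var} {C : Fma Var} →
            T ∣ Γ ⊢R A → just A ∣ Δ ⊢L C → T ∣ Γ ++ Δ ⊢L C
    scutR _ ax g          = g
    scutR _ IR (IL g)     = g
    scutR (A ⊗ B) (⊗R {Γ = Γ} {Δ = Δ′} _ f h) (⊗L {Γ = Δ} g) =
      cast-cxt (sym (++-assoc Γ Δ′ Δ)) (scutR A f (ccut B [] Δ h g refl))

    ccut : (A : Fma Var) (Δ₀ Δ₁ : Cxt Var) {S : Stp Var} {Γ Δ : Cxt Var} {C : Fma Var} →
           nothing ∣ Γ ⊢L A → S ∣ Δ ⊢L C → Δ ≡ Δ₀ ++ A ∷ Δ₁ → S ∣ Δ₀ ++ Γ ++ Δ₁ ⊢L C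
    ccut A []       Δ₁ f (pass g)     refl = scut A f g
    ccut A (_ ∷ Δ₀) Δ₁ f (pass g)     refl = pass (ccut A Δ₀ Δ₁ f g refl)
    ccut A Δ₀       Δ₁ f (switch i g) eq   = ccutR A Δ₀ Δ₁ i f g eq
    ccut A Δ₀       Δ₁ f (IL g)       eq   = IL (ccut A Δ₀ Δ₁ f g eq)
    ccut A Δ₀       Δ₁ f (⊗L {B = B} g) eq = ⊗L (ccut A (B ∷ Δ₀) Δ₁ f g (cong (B ∷_) eq))

    ccutR : (A : Fma Var) (Δ₀ Δ₁ : Cxt Var) {T : Stp Var} {Γ Δ : Cxt Var} {C : Fma Var} →
            Irr T → nothing ∣ Γ ⊢L A → T ∣ Δ ⊢R C → Δ ≡ Δ₀ ++ A ∷ Δ₁ →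
            T ∣ Δ₀ ++ Γ ++ Δ₁ ⊢L C
    ccutR A Δ₀ Δ₁ _ _ ax eq = ⊥-elim ([]≢++∷ Δ₀ Δ₁ A eq)
    ccutR A Δ₀ Δ₁ _ _ IR eq = ⊥-elim ([]≢++∷ Δ₀ Δ₁ A eq)
    ccutR A Δ₀ Δ₁ {Γ = Γ} _ f (⊗R {Γ = Γ′} {Δ = Δ′} i g h) eq
      with split-++≡++∷ Γ′ Δ′ Δ₀ Δ₁ A eq
    ... | inj₁ (Ξ , refl , refl) =
      cast-cxt (trans (++-assoc Δ₀ (Γ ++ Ξ) Δ′) (cong (Δ₀ ++_) (++-assoc Γ Ξ Δ′)))
        (⊗R-admissible (ccutR A Δ₀ Ξ i f g refl) h)
    ... | inj₂ (Ξ , refl , refl) =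
      cast-cxt (sym (++-assoc Γ′ Ξ (Γ ++ Δ₁)))
        (switch i (⊗R i g (ccut A Ξ Δ₁ f h refl)))

lemma5p3 : {Var : Set} →
    -- (ax)
    ((A : Fma Var) → just A ∣ [] ⊢L A)
    -- (IR)
    × (nothing ∣ [] ⊢L I {Var})
    -- (⊗R)
    × ((S : Stp Var) (Γ Δ : Cxt Var) (A B : Fma Var) →
        S ∣ Γ ⊢L A → nothing ∣ Δ ⊢L B → S ∣ Γ ++ Δ ⊢L (A ⊗ B))
    -- (scut)
    × ((S : Stp Var) (Γ Δ : Cxt Var) (A C : Fma Var) →
        S ∣ Γ ⊢L A → just A ∣ Δ ⊢L C → S ∣ Γ ++ Δ ⊢L C)
    -- (ccut)
    × ((S : Stp Var) (Γ Δ₀ Δ₁ : Cxt Var) (A C : Fma Var) →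
        nothing ∣ Γ ⊢L A → S ∣ Δ₀ ++ A ∷ Δ₁ ⊢L C → S ∣ Δ₀ ++ Γ ++ Δ₁ ⊢L C)
lemma5p3 =
    ax-admissible
  , IR-admissible
  , (λ _ _ _ _ _ → ⊗R-admissible)
  , (λ _ _ _ A _ → scut A)
  , (λ _ _ Δ₀ Δ₁ A _ f g → ccut A Δ₀ Δ₁ f g refl)
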